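{- Let $G=(V,E)$ satisfy the standing assumptions and have highway dimension at most $h$, and fix a valid hierarchy of $G$. Then for all $v_1,v_2\in V$, $d_G(v_1,v_2)=d_{F_G(v_1,v_2)}(v_1,v_2)$.
   Context: Standing assumptions: $G$ is a finite connected undirected graph, edge weights at least $1$, shortest paths unique ($p(u,w)$, length $d(u,w)$), every edge is the shortest path between its endpoints. $B(v,r)=\{v': d(v,v')\le r\}$; $\mathrm{maxedge}(p)$ is the maximum edge weight on $p$. Highway dimension: an $r$-witness of a shortest path $p$ from $u$ to $w$ is a shortest path $p'$ of length at least $r$ containing $p$, with endpoints $u$ or a neighbor of $u$, and $w$ or a neighbor of $w$; $p$ is $r$-significant if it has one; $d(v,q)$ is the distance from $v$ to the nearest vertex of $q$; $S(v,r)$ is the set of $r$-significant paths with an $r$-witness $p'$ with $d(v,p')\le 2r$; the highway dimension is the least $h$ such that for all $r>0,v$ some $C\subseteq V$, $|C|\le h$, meets every path of $S(v,r)$. Shortcut graph $G(C,r)$: vertex set $C$, edge $\{v_1,v_2\}$ of weight $d(v_1,v_2)$ iff $d(v_1,v_2)\le r$ and $p(v_1,v_2)$ contains no element of $C$ besides $v_1,v_2$. Hierarchy: $E[i]$ ($i\ge -1$) is the set of edges of weight in $(8^{i-1},8^i]$, $E[\ge i]=\bigcup_{j\ge i}E[j]$. $C'[-1]=\emptyset$, $G[-1]$ empty; $C[i]=C'[i]\cup V(E[\ge i])$ for $i\ge -1$; $G[i]=G(C[i],8^i)$ for $i\ge0$. For $i\ge0$ a valid $C'[i]$ is obtained by: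 start with $\emptyset$; for each pair $v,v'\in V(G[i-1])$ (arbitrary order) with $d_{G[i-1]}(v,v')\in[\frac34 8^i,8^i]$ and $\mathrm{maxedge}(p_G(v,v'))\le 8^{i-1}$, if $p_{G[i-1]}(v,v')$ has no element of $C'[i]$, add the vertex of $G[i-1]$ on it closest to its midpoint; a valid hierarchy uses a valid $C'[i]$ at each level. The funnel graph $F_G(v_1,v_2)$ is the union over $i\ge 0$ of the subgraphs of $G[i]$ induced on the vertices of $G[i]$ lying in $B(v_1,8^{i+1})\cup B(v_2,8^{i+1})$ (edges keep their weights from $G[i]$).
   Formalization: The edge weights of G are rational, and in the definition of highway dimension the radius r is taken over the positive rationals. -}

module Defs where

open import Data.Nat using (ℕ; zero; suc)
import Data.Nat
import Data.List
open import Data.Integer using (+_)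
open import Data.Rational using (ℚ; _≤_; _<_; _+_; _*_; _-_; ∣_∣; ½; 0ℚ; 1ℚ; _/_)
open import Data.Fin using (Fin)
open import Data.List using (List; []; _∷_; _++_; map)
open import Data.List.Membership.Propositional using (_∈_)
open import Data.List.Relation.Unary.All using (All)
open import Data.List.Relation.Unary.Unique.Propositional using (Unique)
open import Data.Product using (Σ; ∃; ∃-syntax; _×_; _,_)
open import Data.Sum using (_⊎_)
open import Data.Empty using (⊥)
open import Relation.Nullary using (¬_)
open import Relation.Binary.PropositionalEquality using (_≡_; _≢_)

-- Powers of 8 as rationals.
-- pow8 i = 8^i (i ≥ 0);  low i = 8^(i-1) (so low 0 = 1/8).

pow8 : ℕ → ℚ
pow8 zero    = 1ℚ
pow8 (suc i) = (+ 8 / 1) * pow8 i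

low : ℕ → ℚ
low zero    = + 1 / 8
low (suc i) = pow8 i

-- General weighted graphs on the vertex universe Fin n, given by an
-- edge relation  E u v x  ("there is an edge {u,v} of weight x").

WRel : ℕ → Set₁
WRel n = Fin n → Fin n → ℚ → Set

data Walk {n : ℕ} (E : WRel n) : Fin n → Fin n → Set where
  stay : (u : Fin n) → Walk E u u
  step : (u : Fin n) {v w : Fin n} (x : ℚ) → E u v x → Walk E v w → Walk E u w

module _ {n : ℕ} {E : WRel n} where

  len : {u w : Fin n} → Walk E u w → ℚ
  len (stay _)         = 0ℚ
  len (step _ x _ p)   = x + len p

  verts : {u w : Fin n} → Walk E u w → List (Fin n)
  verts (stay u)       = u ∷ []
  verts (step u _ _ p) = u ∷ verts p

  weights : {u w : Fin n} → Walk E u w → List ℚ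
  weights (stay _)       = []
  weights (step _ x _ p) = x ∷ weights p

  positionsFrom : ℚ → {u w : Fin n} → Walk E u w → List (Fin n × ℚ)
  positionsFrom a (stay u)       = (u , a) ∷ []
  positionsFrom a (step u x _ p) = (u , a) ∷ positionsFrom (a + x) p

  positions : {u w : Fin n} → Walk E u w → List (Fin n × ℚ)
  positions = positionsFrom 0ℚ

IsShortestIn : {n : ℕ} (E : WRel n) {u w : Fin n} → Walk E u w → Set
IsShortestIn E {u} {w} q = (q' : Walk E u w) → len q ≤ len q'

IsDistIn : {n : ℕ} (E : WRel n) → Fin n → Fin n → ℚ → Set
IsDistIn E u w D =
  Σ (Walk E u w) (λ q → len q ≡ D) × ((q' : Walk E u w) → D ≤ len q')

record Graph (n : ℕ) : Set₁ where
  field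
    Adj : Fin n → Fin n → Set
    wt  : Fin n → Fin n → ℚ

module _ {n : ℕ} (G : Graph n) where
  open Graph G

  EG : WRel n
  EG u v x = Adj u v × x ≡ wt u v

  record Standing (d : Fin n → Fin n → ℚ) : Set where
    field
      adj-sym    : ∀ u v → Adj u v → Adj v u
      wt-sym     : ∀ u v → Adj u v → wt u v ≡ wt v u
      wt≥1       : ∀ u v → Adj u v → 1ℚ ≤ wt u v
      connected  : ∀ u v → Walk EG u v
      d-is-dist  : ∀ u v → IsDistIn EG u v (d u v)
      unique-sp  : ∀ u v (p q : Walk EG u v) → len p ≡ d u v → len q ≡ d u v →
                   verts p ≡ verts q
      edge-sp    : ∀ u v → Adj u v → d u v ≡ wt u v

  module _ (d : Fin n → Fin n → ℚ) where

    IsSP : {u w : Fin n} → Walk EG u w → Set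
    IsSP {u} {w} p = len p ≡ d u w

    IsWitness : (r : ℚ) {u w : Fin n} → Walk EG u w →
                {u' w' : Fin n} → Walk EG u' w' → Set
    IsWitness r {u} {w} p {u'} {w'} p' =
      IsSP p' × r ≤ len p' ×
      (∃[ pre ] ∃[ suf ] verts p' ≡ pre ++ verts p ++ suf) ×
      (u' ≡ u ⊎ Adj u u') × (w' ≡ w ⊎ Adj w w')

    InS : Fin n → ℚ → {u w : Fin n} → Walk EG u w → Set
    InS v r p =
      IsSP p ×
      (∃[ u' ] ∃[ w' ] Σ (Walk EG u' w') λ p' →
         IsWitness r p p' ×
         (∃[ x ] x ∈ verts p' × d v x ≤ (+ 2 / 1) * r))

    HighwayDim≤ : ℕ → Set
    HighwayDim≤ h =
      (r : ℚ) → 0ℚ < r → (v : Fin n) →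
      ∃[ C ] (Data.List.length C Data.Nat.≤ h) ×
        (∀ u w (p : Walk EG u w) → InS v r p → ∃[ c ] c ∈ C × c ∈ verts p)

    -- shortcut graph G(C,r); its vertex set is C
    Shortcut : (Fin n → Set) → ℚ → WRel n
    Shortcut C r u v x =
      C u × C v × u ≢ v × x ≡ d u v × d u v ≤ r ×
      ((p : Walk EG u v) → IsSP p → ∀ y → y ∈ verts p → C y → y ≡ u ⊎ y ≡ v)

    module Hierarchy (C' : ℕ → List (Fin n)) where

      InE≥ : ℕ → Fin n → Set
      InE≥ i u = ∃[ v ] Adj u v × low i < wt u v

      C : ℕ → Fin n → Set
      C i x = x ∈ C' i ⊎ InE≥ i x

      GE : ℕ → WRel n
      GE i = Shortcut (C i) (pow8 i)

      GV : ℕ → Fin n → Set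
      GV = C

      -- G[i-1] for i ≥ 0 (G[-1] is empty)
      PrevE : ℕ → WRel n
      PrevE zero    = λ _ _ _ → ⊥
      PrevE (suc i) = GE i

      PrevV : ℕ → Fin n → Set
      PrevV zero    = λ _ → ⊥
      PrevV (suc i) = GV i

      Qualifies : ℕ → Fin n → Fin n → Set
      Qualifies i v v' =
        PrevV i v × PrevV i v' ×
        (∃[ D ] IsDistIn (PrevE i) v v' D ×
                ((+ 3 / 4) * pow8 i) ≤ D × D ≤ pow8 i) ×
        ((p : Walk EG v v') → IsSP p → All (λ x → x ≤ low i) (weights p))

      ClosestToMid : {u w : Fin n} {E : WRel n} → Walk E u w → Fin n → Set
      ClosestToMid q m =
        ∃[ a ] (m , a) ∈ positions q ×
          (∀ y b → (y , b) ∈ positions q →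
             ∣ a - len q * ½ ∣ ≤ ∣ b - len q * ½ ∣)

      data Run (i : ℕ) : List (Fin n × Fin n) → List (Fin n) → List (Fin n) → Set where
        done : ∀ {S} → Run i [] S S
        skip : ∀ {v v' ps S T} (q : Walk (PrevE i) v v') →
               IsShortestIn (PrevE i) q →
               (∃[ x ] x ∈ verts q × x ∈ S) →
               Run i ps S T → Run i ((v , v') ∷ ps) S T
        add  : ∀ {v v' ps S T} (q : Walk (PrevE i) v v') →
               IsShortestIn (PrevE i) q →
               (∀ x → x ∈ verts q → ¬ (x ∈ S)) →
               (m : Fin n) → ClosestToMid q m →
               Run i ps (m ∷ S) T → Run i ((v , v') ∷ ps) S T

      ValidLevel : ℕ → Set
      ValidLevel i =
        ∃[ ps ] Unique ps ×
          (∀ v v' → (Qualifies i v v' → (v , v') ∈ ps) ×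
                    ((v , v') ∈ ps → Qualifies i v v')) ×
          Run i ps [] (C' i)

      Valid : Set
      Valid = ∀ i → ValidLevel i

      InBall : Fin n → ℚ → Fin n → Set
      InBall v r x = d v x ≤ r

      FunnelE : Fin n → Fin n → WRel n
      FunnelE v₁ v₂ a b x =
        ∃[ i ] GE i a b x ×
          (InBall v₁ (pow8 (suc i)) a ⊎ InBall v₂ (pow8 (suc i)) a) ×
          (InBall v₁ (pow8 (suc i)) b ⊎ InBall v₂ (pow8 (suc i)) b)

{-# OPTIONS --safe #-}
module Submission where

-- Call a path light at level i if its edges weigh at most 8^i. Two facts about light shortest paths
-- are proved by simultaneous induction on i: consecutive C[i]-vertices on such a path are at most
-- 8^i apart, hence adjacent in G[i]; and a path of length at least 6·8^i between C[i]-vertices has a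
-- C[i+1]-vertex within 7·8^i of its start, because walking along its C[i]-vertices reaches a prefix
-- of length in [6·8^i, 7·8^i), whose ends were examined when C'[i+1] was built.
-- The funnel path is then built level by level: at level i the still unlifted middle part of
-- p(v₁, v₂) runs between C[i]-vertices. Its pieces before the first and after the last C[i+1]-vertex
-- are light and at most 7·8^i long, so they lie within 8^(i+1) of v₁ resp. v₂ and lift to G[i];
-- once the middle part has no C[i+1]-vertex, or d(v₁, v₂) ≤ 8^i, it is lifted to G[i] as a whole.

open import Defs
open import Data.Nat as ℕ using (ℕ; zero; suc; s≤s; _^_)
import Data.Nat.Properties as ℕ
open import Data.Nat.Coprimality as Coprimality using (Coprime; 1-coprimeTo)
open import Data.Integer as ℤ using (+_; -[1+_])
import Data.Integer.Properties as ℤ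
open import Data.Rational using (ℚ; 0ℚ; 1ℚ; _≤_; _<_; _+_; _*_; _/_; mkℚ; *≤*)
open import Data.Rational.Properties
  using (≤-refl; ≤-trans; ≤-antisym; ≤-reflexive; <-irrefl; <⇒≤; <-≤-trans; ≤-<-trans;
         ≮⇒≥; ≰⇒>; _≤?_; _<?_; +-mono-≤; +-mono-<-≤; +-mono-≤-<;
         +-identityˡ; +-identityʳ; +-comm; +-assoc; *-monoˡ-≤-nonNeg; normalize-coprime; module ≤-Reasoning)
open import Data.Rational.Solver using (module +-*-Solver)
open import Data.Fin as Fin using (Fin)
import Data.Fin.Properties as Fin
open import Data.List using (List; []; _∷_; _++_)
open import Data.List.Properties using (∷-injectiveʳ; ∷-injectiveˡ)
open import Data.List.Membership.Propositional using (_∈_)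
import Data.List.Membership.DecPropositional as DecMembership
open import Data.List.Relation.Unary.Any using (here; there)
open import Data.List.Relation.Unary.All as All using (All; []; _∷_)
import Data.List.Relation.Unary.All.Properties as All
open import Data.Product using (Σ; ∃; ∃-syntax; _×_; _,_; proj₁; proj₂)
open import Data.Sum using (_⊎_; inj₁; inj₂)
open import Data.Empty using (⊥-elim)
open import Data.Unit using (⊤; tt)
open import Function using (_∘_)
open import Relation.Nullary using (¬_; Dec; yes; no)
open import Relation.Nullary.Decidable using (toWitness; _×-dec_; _⊎-dec_)
open import Relation.Unary using (Decidable)
open import Relation.Binary.PropositionalEquality

module _ {n : ℕ} {E : WRel n} where

  infixr 5 _++ʷ_
  _++ʷ_ : ∀ {a b c} → Walk E a b → Walk E b c → Walk E a c
  stay _       ++ʷ q = q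
  step u x e p ++ʷ q = step u x e (p ++ʷ q)

  len-++ʷ : ∀ {a b c} (p : Walk E a b) (q : Walk E b c) → len (p ++ʷ q) ≡ len p + len q
  len-++ʷ (stay _)       q = sym (+-identityˡ _)
  len-++ʷ (step _ x _ p) q = trans (cong (_+_ x) (len-++ʷ p q)) (sym (+-assoc x (len p) (len q)))

  ++ʷ-assoc : ∀ {a b c d} (p : Walk E a b) (q : Walk E b c) (r : Walk E c d) →
              (p ++ʷ q) ++ʷ r ≡ p ++ʷ (q ++ʷ r)
  ++ʷ-assoc (stay _)       q r = refl
  ++ʷ-assoc (step u x e p) q r = cong (step u x e) (++ʷ-assoc p q r)

  ++ʷ-identityʳ : ∀ {a b} (p : Walk E a b) → p ++ʷ stay b ≡ p
  ++ʷ-identityʳ (stay _)       = refl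
  ++ʷ-identityʳ (step u x e p) = cong (step u x e) (++ʷ-identityʳ p)

  weights-++ʷ : ∀ {a b c} (p : Walk E a b) (q : Walk E b c) → weights (p ++ʷ q) ≡ weights p ++ weights q
  weights-++ʷ (stay _)       q = refl
  weights-++ʷ (step _ x _ p) q = cong (x ∷_) (weights-++ʷ p q)

  #edges : ∀ {a b} → Walk E a b → ℕ
  #edges (stay _)       = 0
  #edges (step _ _ _ p) = suc (#edges p)

  #edges-suffix : ∀ {a b c} (p : Walk E a b) (q : Walk E b c) → #edges q ℕ.≤ #edges (p ++ʷ q)
  #edges-suffix (stay _)       q = ℕ.≤-refl
  #edges-suffix (step _ _ _ p) q = ℕ.m≤n⇒m≤1+n (#edges-suffix p q)

  start∈verts : ∀ {a b} (p : Walk E a b) → a ∈ verts p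
  start∈verts (stay _)       = here refl
  start∈verts (step _ _ _ _) = here refl

  end∈verts : ∀ {a b} (p : Walk E a b) → b ∈ verts p
  end∈verts (stay _)       = here refl
  end∈verts (step _ _ _ p) = there (end∈verts p)

  ∈-++ʷ⁺ˡ : ∀ {a b c y} (p : Walk E a b) (q : Walk E b c) → y ∈ verts p → y ∈ verts (p ++ʷ q)
  ∈-++ʷ⁺ˡ (stay _)       q (here refl) = start∈verts q
  ∈-++ʷ⁺ˡ (step _ _ _ p) q (here refl) = here refl
  ∈-++ʷ⁺ˡ (step _ _ _ p) q (there y∈p) = there (∈-++ʷ⁺ˡ p q y∈p)

  ∈-++ʷ⁺ʳ : ∀ {a b c y} (p : Walk E a b) (q : Walk E b c) → y ∈ verts q → y ∈ verts (p ++ʷ q)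
  ∈-++ʷ⁺ʳ (stay _)       q y∈q = y∈q
  ∈-++ʷ⁺ʳ (step _ _ _ p) q y∈q = there (∈-++ʷ⁺ʳ p q y∈q)

  ∈-++ʷ⁻ : ∀ {a b c y} (p : Walk E a b) (q : Walk E b c) → y ∈ verts (p ++ʷ q) → y ∈ verts p ⊎ y ∈ verts q
  ∈-++ʷ⁻ (stay _)       q y∈pq         = inj₂ y∈pq
  ∈-++ʷ⁻ (step _ _ _ p) q (here refl)  = inj₁ (here refl)
  ∈-++ʷ⁻ (step _ _ _ p) q (there y∈pq) with ∈-++ʷ⁻ p q y∈pq
  ... | inj₁ y∈p = inj₁ (there y∈p)
  ... | inj₂ y∈q = inj₂ y∈q

  ∈-positionsFrom⁻ : ∀ {a b y t} (s : ℚ) (p : Walk E a b) → (y , t) ∈ positionsFrom s p → y ∈ verts p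
  ∈-positionsFrom⁻ s (stay _)       (here refl) = here refl
  ∈-positionsFrom⁻ s (step _ _ _ p) (here refl) = here refl
  ∈-positionsFrom⁻ s (step _ x _ p) (there y∈p) = there (∈-positionsFrom⁻ (s + x) p y∈p)

  record Cut {a b : Fin n} (s : Walk E a b) : Set where
    constructor cut
    field
      {mid}   : Fin n
      pre     : Walk E a mid
      suf     : Walk E mid b
      pre++suf : pre ++ʷ suf ≡ s

  cut-++ʷʳ : ∀ {a b c} {p : Walk E a b} {s : Walk E a c} (k : Cut p) (q : Walk E b c) → p ++ʷ q ≡ s → Cut s
  cut-++ʷʳ k q pq≡s =
    cut (Cut.pre k) (Cut.suf k ++ʷ q)
        (trans (sym (++ʷ-assoc (Cut.pre k) (Cut.suf k) q)) (trans (cong (_++ʷ q) (Cut.pre++suf k)) pq≡s))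

  All-weights-cut⁻ : ∀ {P : ℚ → Set} {a b} {s : Walk E a b} (c : Cut s) →
                     All P (weights s) → All P (weights (Cut.pre c)) × All P (weights (Cut.suf c))
  All-weights-cut⁻ (cut p q refl) = All.++⁻ (weights p) ∘ subst (All _) (weights-++ʷ p q)

  cut-++ʷˡ : ∀ {a b c} {q : Walk E b c} (p : Walk E a b) → Cut q → Cut (p ++ʷ q)
  cut-++ʷˡ p k =
    cut (p ++ʷ Cut.pre k) (Cut.suf k) (trans (++ʷ-assoc p (Cut.pre k) (Cut.suf k)) (cong (p ++ʷ_) (Cut.pre++suf k)))

  len-cut : ∀ {a b} {s : Walk E a b} (c : Cut s) → len s ≡ len (Cut.pre c) + len (Cut.suf c)
  len-cut (cut p q refl) = len-++ʷ p q

  mid∈verts : ∀ {a b} {s : Walk E a b} (c : Cut s) → Cut.mid c ∈ verts s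
  mid∈verts (cut p q refl) = ∈-++ʷ⁺ˡ p q (end∈verts p)

  cutAt : ∀ {a b y} (s : Walk E a b) → y ∈ verts s → Σ (Cut s) λ c → Cut.mid c ≡ y
  cutAt (stay _)       (here refl) = cut (stay _) (stay _) refl , refl
  cutAt (step u x e p) (here refl) = cut (stay u) (step u x e p) refl , refl
  cutAt (step u x e p) (there y∈p) with cutAt p y∈p
  ... | cut p₁ p₂ refl , refl = cut (step u x e p₁) p₂ refl , refl

  module _ (P : Fin n → Set) where

    AvoidsBeforeEnd AvoidsAfterStart AvoidsInterior : ∀ {a b} → Walk E a b → Set
    AvoidsBeforeEnd  {a} {b} s = ∀ y → y ∈ verts s → y ≢ b → ¬ P y
    AvoidsAfterStart {a} {b} s = ∀ y → y ∈ verts s → y ≢ a → ¬ P y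
    AvoidsInterior   {a} {b} s = ∀ y → y ∈ verts s → y ≢ a → y ≢ b → ¬ P y

    Avoids : ∀ {a b} → Walk E a b → Set
    Avoids s = ∀ y → y ∈ verts s → ¬ P y

    FirstHit LastHit : ∀ {a b} → Walk E a b → Set
    FirstHit s = Σ (Cut s) λ c → P (Cut.mid c) × AvoidsBeforeEnd (Cut.pre c)
    LastHit  s = Σ (Cut s) λ c → P (Cut.mid c) × AvoidsAfterStart (Cut.suf c)

  module _ {P : Fin n → Set} (P? : Decidable P) where

    findFirst : ∀ {a b} (s : Walk E a b) → Avoids P s ⊎ FirstHit P s
    findFirst (stay a) with P? a
    ... | yes pa = inj₂ (cut (stay a) (stay a) refl , pa , λ { _ (here refl) a≢a → ⊥-elim (a≢a refl) })
    ... | no ¬pa = inj₁ λ { _ (here refl) → ¬pa }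
    findFirst (step a x e r) with P? a
    ... | yes pa = inj₂ (cut (stay a) (step a x e r) refl , pa , λ { _ (here refl) a≢a → ⊥-elim (a≢a refl) })
    ... | no ¬pa with findFirst r
    ...   | inj₁ avoids = inj₁ λ { _ (here refl) → ¬pa ; y (there y∈r) → avoids y y∈r }
    ...   | inj₂ (cut r₁ r₂ refl , py , avoids) =
            inj₂ (cut (step a x e r₁) r₂ refl , py ,
                  λ { _ (here refl) _ → ¬pa ; y (there y∈r₁) → avoids y y∈r₁ })

    findLast : ∀ {a b} (s : Walk E a b) → Avoids P s ⊎ LastHit P s
    findLast (stay a) with P? a
    ... | yes pa = inj₂ (cut (stay a) (stay a) refl , pa , λ { _ (here refl) a≢a → ⊥-elim (a≢a refl) })
    ... | no ¬pa = inj₁ λ { _ (here refl) → ¬pa }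
    findLast (step a x e r) with findLast r
    ... | inj₂ (cut r₁ r₂ refl , py , avoids) = inj₂ (cut (step a x e r₁) r₂ refl , py , avoids)
    ... | inj₁ avoids with P? a
    ...   | yes pa = inj₂ (cut (stay a) (step a x e r) refl , pa ,
                           λ { _ (here refl) a≢a → ⊥-elim (a≢a refl) ; y (there y∈r) _ → avoids y y∈r })
    ...   | no ¬pa = inj₁ λ { _ (here refl) → ¬pa ; y (there y∈r) → avoids y y∈r }

    findNext : ∀ {u v b x} → P b → (e : E u v x) (r : Walk E v b) →
               Σ (Cut r) λ c → P (Cut.mid c) × AvoidsInterior P (step u x e (Cut.pre c))
    findNext {b = b} pb e r with findFirst r
    ... | inj₁ avoids = ⊥-elim (avoids b (end∈verts r) pb)
    ... | inj₂ (c , py , avoids) =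
          c , py , λ { _ (here refl) u≢u → ⊥-elim (u≢u refl) ; y (there y∈r₁) _ → avoids y y∈r₁ }

mapʷ : ∀ {n} {E E' : WRel n} → (∀ {u v x} → E u v x → E' u v x) → ∀ {a b} → Walk E a b → Walk E' a b
mapʷ f (stay u)       = stay u
mapʷ f (step u x e p) = step u x (f e) (mapʷ f p)

len-mapʷ : ∀ {n} {E E' : WRel n} (f : ∀ {u v x} → E u v x → E' u v x) {a b} (p : Walk E a b) →
           len (mapʷ f p) ≡ len p
len-mapʷ f (stay u)       = refl
len-mapʷ f (step u x e p) = cong (_+_ x) (len-mapʷ f p)

x≤x+y : ∀ {x y} → 0ℚ ≤ y → x ≤ x + y
x≤x+y {x} 0≤y = ≤-trans (≤-reflexive (sym (+-identityʳ x))) (+-mono-≤ (≤-refl {x}) 0≤y)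

+-mono-≤-rigid : ∀ {x X y Y} → x ≤ X → y ≤ Y → X + Y ≤ x + y → X ≡ x × Y ≡ y
+-mono-≤-rigid x≤X y≤Y X+Y≤x+y =
  ≤-antisym (≮⇒≥ λ x<X → <-irrefl refl (<-≤-trans (+-mono-<-≤ x<X y≤Y) X+Y≤x+y)) x≤X ,
  ≤-antisym (≮⇒≥ λ y<Y → <-irrefl refl (<-≤-trans (+-mono-≤-< x≤X y<Y) X+Y≤x+y)) y≤Y

0≤1 : 0ℚ ≤ 1ℚ
0≤1 = toWitness {a? = 0ℚ ≤? 1ℚ} _

0<1 : 0ℚ < 1ℚ
0<1 = toWitness {a? = 0ℚ <? 1ℚ} _

6·8^_ 7·8^_ : ℕ → ℚ
6·8^ i = (+ 6 / 1) * pow8 i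
7·8^ i = (+ 7 / 1) * pow8 i

1≤8^ : ∀ i → 1ℚ ≤ pow8 i
1≤8^ zero    = ≤-refl
1≤8^ (suc i) = ≤-trans (toWitness {a? = 1ℚ ≤? (+ 8 / 1) * 1ℚ} _) (*-monoˡ-≤-nonNeg (+ 8 / 1) (1≤8^ i))

0≤8^ : ∀ i → 0ℚ ≤ pow8 i
0≤8^ i = ≤-trans 0≤1 (1≤8^ i)

0<6·8^ : ∀ i → 0ℚ < 6·8^ i
0<6·8^ i = <-≤-trans (toWitness {a? = 0ℚ <? (+ 6 / 1) * 1ℚ} _) (*-monoˡ-≤-nonNeg (+ 6 / 1) (1≤8^ i))

module _ where
  open +-*-Solver

  6·8^+8^≡7·8^ : ∀ i → 6·8^ i + pow8 i ≡ 7·8^ i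
  6·8^+8^≡7·8^ i = solve 1 (λ x → con (+ 6 / 1) :* x :+ x := con (+ 7 / 1) :* x) refl (pow8 i)

  8^+7·8^≡8^suc : ∀ i → pow8 i + 7·8^ i ≡ pow8 (suc i)
  8^+7·8^≡8^suc i = solve 1 (λ x → x :+ con (+ 7 / 1) :* x := con (+ 8 / 1) :* x) refl (pow8 i)

  ¾·8^suc≡6·8^ : ∀ i → (+ 3 / 4) * pow8 (suc i) ≡ 6·8^ i
  ¾·8^suc≡6·8^ i = solve 1 (λ x → con (+ 3 / 4) :* (con (+ 8 / 1) :* x) := con (+ 6 / 1) :* x) refl (pow8 i)

6·8^≤7·8^ : ∀ i → 6·8^ i ≤ 7·8^ i
6·8^≤7·8^ i = ≤-trans (x≤x+y (0≤8^ i)) (≤-reflexive (6·8^+8^≡7·8^ i))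

≤8^+≤7·8^⇒≤8^suc : ∀ i {x y} → x ≤ pow8 i → y ≤ 7·8^ i → x + y ≤ pow8 (suc i)
≤8^+≤7·8^⇒≤8^suc i x≤ y≤ = ≤-trans (+-mono-≤ x≤ y≤) (≤-reflexive (8^+7·8^≡8^suc i))

7·8^≤8^suc : ∀ i → 7·8^ i ≤ pow8 (suc i)
7·8^≤8^suc i = subst (_≤ pow8 (suc i)) (+-identityˡ (7·8^ i)) (≤8^+≤7·8^⇒≤8^suc i (0≤8^ i) ≤-refl)

8^≤8^suc : ∀ i → pow8 i ≤ pow8 (suc i)
8^≤8^suc i = subst (_≤ pow8 (suc i)) (+-identityʳ (pow8 i))
  (≤8^+≤7·8^⇒≤8^suc i ≤-refl (≤-trans (<⇒≤ (0<6·8^ i)) (6·8^≤7·8^ i)))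

low≤low-suc : ∀ i → low i ≤ low (suc i)
low≤low-suc zero    = toWitness {a? = low 0 ≤? 1ℚ} _
low≤low-suc (suc i) = 8^≤8^suc i

coprime-1 : ∀ m → Coprime m 1
coprime-1 m = Coprimality.sym (1-coprimeTo m)

8^≡ : ∀ k → pow8 k ≡ mkℚ (+ (8 ^ k)) 0 (coprime-1 (8 ^ k))
8^≡ zero    = refl
8^≡ (suc k) = trans (cong (_*_ (+ 8 / 1)) (8^≡ k)) (trans (cong (λ z → z / 1) (ℤ.+◃n≡+n (8 ℕ.* 8 ^ k)))
                                                        (normalize-coprime (coprime-1 (8 ℕ.* 8 ^ k))))

m<8^m : ∀ m → m ℕ.< 8 ^ m
m<8^m zero    = s≤s ℕ.z≤n
m<8^m (suc m) = subst (ℕ._≤ 8 ^ suc m) (ℕ.+-comm (suc m) 1)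
                  (ℕ.+-mono-≤ (m<8^m m) (ℕ.≤-trans (ℕ.≤-trans (s≤s ℕ.z≤n) (m<8^m m)) (ℕ.m≤m+n (8 ^ m) _)))

8^-unbounded : ∀ q → ∃ λ k → q ≤ pow8 k
8^-unbounded (mkℚ -[1+ m ] _ _) = 0 , *≤* ℤ.-≤+
8^-unbounded (mkℚ (+ m) d c)     = m , subst (mkℚ (+ m) d c ≤_) (sym (8^≡ m))
  (*≤* (subst₂ ℤ._≤_ (sym (ℤ.+◃n≡+n (m ℕ.* 1))) (sym (ℤ.+◃n≡+n (8 ^ m ℕ.* suc d)))
     (ℤ.+≤+ (ℕ.≤-trans (ℕ.≤-reflexive (ℕ.*-identityʳ m))
        (ℕ.≤-trans (ℕ.<⇒≤ (m<8^m m)) (ℕ.m≤m*n (8 ^ m) (suc d)))))))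

module ShortestPaths {n : ℕ} (G : Graph n) (d : Fin n → Fin n → ℚ) (st : Standing G d) where
  open Graph G
  open Standing st

  W : Fin n → Fin n → Set
  W = Walk (EG G)

  Shortest : ∀ {a b} → W a b → Set
  Shortest = IsSP G d

  0≤wt : ∀ {u v} → Adj u v → 0ℚ ≤ wt u v
  0≤wt adj = ≤-trans 0≤1 (wt≥1 _ _ adj)

  len-nonneg : ∀ {a b} (p : W a b) → 0ℚ ≤ len p
  len-nonneg (stay _)                  = ≤-refl
  len-nonneg (step _ _ (adj , refl) p) = +-mono-≤ (0≤wt adj) (len-nonneg p)

  d≤len : ∀ {a b} (p : W a b) → d a b ≤ len p
  d≤len {a} {b} = proj₂ (d-is-dist a b)

  sp : ∀ a b → W a b
  sp a b = proj₁ (proj₁ (d-is-dist a b))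

  sp-shortest : ∀ a b → Shortest (sp a b)
  sp-shortest a b = proj₂ (proj₁ (d-is-dist a b))

  d-nonneg : ∀ a b → 0ℚ ≤ d a b
  d-nonneg a b = subst (0ℚ ≤_) (sp-shortest a b) (len-nonneg (sp a b))

  d-refl : ∀ a → d a a ≡ 0ℚ
  d-refl a = ≤-antisym (d≤len (stay a)) (d-nonneg a a)

  d-triangle : ∀ a b c → d a c ≤ d a b + d b c
  d-triangle a b c = begin
    d a c                          ≤⟨ d≤len (sp a b ++ʷ sp b c) ⟩
    len (sp a b ++ʷ sp b c)        ≡⟨ len-++ʷ (sp a b) (sp b c) ⟩
    len (sp a b) + len (sp b c)    ≡⟨ cong₂ _+_ (sp-shortest a b) (sp-shortest b c) ⟩
    d a b + d b c                  ∎
    where open ≤-Reasoning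

  len-pre≤ : ∀ {a b} {s : W a b} (c : Cut s) → len (Cut.pre c) ≤ len s
  len-pre≤ c = ≤-trans (x≤x+y (len-nonneg (Cut.suf c))) (≤-reflexive (sym (len-cut c)))

  len-suf≤ : ∀ {a b} {s : W a b} (c : Cut s) → len (Cut.suf c) ≤ len s
  len-suf≤ c = ≤-trans (x≤x+y (len-nonneg (Cut.pre c)))
                       (≤-reflexive (trans (+-comm (len (Cut.suf c)) (len (Cut.pre c))) (sym (len-cut c))))

  weights≤len : ∀ {a b} (s : W a b) → All (_≤ len s) (weights s)
  weights≤len (stay _)                    = []
  weights≤len (step _ x (adj , refl) r) = x≤x+y (len-nonneg r) ∷
    All.map (λ y≤r → ≤-trans y≤r (≤-trans (x≤x+y (0≤wt adj)) (≤-reflexive (+-comm (len r) x)))) (weights≤len r)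

  ++ʷ-shortest⁻ : ∀ {a b c} (p : W a b) (q : W b c) → Shortest (p ++ʷ q) → Shortest p × Shortest q
  ++ʷ-shortest⁻ {a} {b} {c} p q pq-shortest = +-mono-≤-rigid (d≤len p) (d≤len q) (begin
    len p + len q     ≡⟨ len-++ʷ p q ⟨
    len (p ++ʷ q)     ≡⟨ pq-shortest ⟩
    d a c             ≤⟨ d-triangle a b c ⟩
    d a b + d b c     ∎)
    where open ≤-Reasoning

  cut-shortest : ∀ {a b} {s : W a b} (c : Cut s) → Shortest s → Shortest (Cut.pre c) × Shortest (Cut.suf c)
  cut-shortest (cut p q refl) = ++ʷ-shortest⁻ p q

  len-cut-at-end : ∀ {a b} {s : W a b} (c : Cut s) → Shortest s → Cut.mid c ≡ b → len s ≡ len (Cut.pre c)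
  len-cut-at-end c shortest refl =
    trans (len-cut c) (trans (cong (_+_ (len (Cut.pre c))) (trans (proj₂ (cut-shortest c shortest)) (d-refl _)))
                             (+-identityʳ (len (Cut.pre c))))

  shortest-step⇒≢ : ∀ {u v b x} (e : EG G u v x) (r : W v b) → Shortest (step u x e r) → u ≢ b
  shortest-step⇒≢ {u} (adj , refl) r shortest refl = <-irrefl refl (begin-strict
    0ℚ                                ≤⟨ len-nonneg r ⟩
    len r                             ≡⟨ +-identityˡ (len r) ⟨
    0ℚ + len r                        <⟨ +-mono-<-≤ (<-≤-trans 0<1 (wt≥1 _ _ adj)) (≤-refl {len r}) ⟩
    len (step u _ (adj , refl) r)     ≡⟨ trans shortest (d-refl u) ⟩
    0ℚ                                ∎)
    where open ≤-Reasoning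

  shortest-step⁻ : ∀ {u v b x} (e : EG G u v x) (r : W v b) → Shortest (step u x e r) → Shortest r
  shortest-step⁻ e r = proj₂ ∘ ++ʷ-shortest⁻ (step _ _ e (stay _)) r

  reverse : ∀ {a b} → W a b → W b a
  reverse (stay a)                 = stay a
  reverse (step u x (adj , x≡) p) =
    reverse p ++ʷ step _ x (adj-sym _ _ adj , trans x≡ (wt-sym _ _ adj)) (stay u)

  len-reverse : ∀ {a b} (p : W a b) → len (reverse p) ≡ len p
  len-reverse (stay a)         = refl
  len-reverse (step u x e p) = begin
    len (reverse p ++ʷ step _ x _ (stay u))  ≡⟨ len-++ʷ (reverse p) _ ⟩
    len (reverse p) + (x + 0ℚ)              ≡⟨ cong₂ _+_ (len-reverse p) (+-identityʳ x) ⟩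
    len p + x                               ≡⟨ +-comm (len p) x ⟩
    x + len p                               ∎
    where open ≡-Reasoning

  ∈-reverse⁻ : ∀ {a b y} (p : W a b) → y ∈ verts (reverse p) → y ∈ verts p
  ∈-reverse⁻ (stay a)       y∈ = y∈
  ∈-reverse⁻ (step u x e p) y∈ with ∈-++ʷ⁻ (reverse p) _ y∈
  ... | inj₁ y∈p                = there (∈-reverse⁻ p y∈p)
  ... | inj₂ (here refl)        = there (start∈verts p)
  ... | inj₂ (there (here refl)) = here refl

  d-sym : ∀ a b → d a b ≡ d b a
  d-sym a b = ≤-antisym (d≤reverse b a) (d≤reverse a b)
    where
    d≤reverse : ∀ a b → d b a ≤ d a b
    d≤reverse a b = ≤-trans (d≤len (reverse (sp a b)))
                            (≤-reflexive (trans (len-reverse (sp a b)) (sp-shortest a b)))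

  reverse-shortest : ∀ {a b} (p : W a b) → Shortest p → Shortest (reverse p)
  reverse-shortest {a} {b} p shortest = trans (len-reverse p) (trans shortest (d-sym a b))

  verts≡⇒weights≡ : ∀ {a b} (p q : W a b) → verts p ≡ verts q → weights p ≡ weights q
  verts≡⇒weights≡ (stay _)                    (stay _)                   eq = refl
  verts≡⇒weights≡ (stay _)                    (step _ _ _ (stay _))      ()
  verts≡⇒weights≡ (stay _)                    (step _ _ _ (step _ _ _ _)) ()
  verts≡⇒weights≡ (step _ _ _ (stay _))       (stay _)                   ()
  verts≡⇒weights≡ (step _ _ _ (step _ _ _ _)) (stay _)                   ()
  verts≡⇒weights≡ (step u x (_ , x≡) p) (step u y (_ , y≡) q) eq with head-vert p | head-vert q
    where
    head-vert : ∀ {v b} (r : W v b) → ∃ λ t → verts r ≡ v ∷ t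
    head-vert (stay _)       = _ , refl
    head-vert (step _ _ _ _) = _ , refl
  ... | _ , p≡ | _ , q≡ with ∷-injectiveˡ (trans (sym p≡) (trans (∷-injectiveʳ eq) q≡))
  ... | refl = cong₂ _∷_ (trans x≡ (sym y≡)) (verts≡⇒weights≡ p q (∷-injectiveʳ eq))

  -- Adjacency is decidable because, by uniqueness of shortest paths, u and v are adjacent
  -- exactly when the shortest path from u to v is a single edge.
  adj? : ∀ u v → Dec (Adj u v)
  adj? u v = from-shortest (sp u v) (sp-shortest u v)
    where
    no-second-vertex : ∀ {w b z} (r : W w z) → ¬ (_≡_ {A = List (Fin n)} (v ∷ []) (b ∷ verts r))
    no-second-vertex (stay _)       ()
    no-second-vertex (step _ _ _ _) ()
    from-shortest : (q : W u v) → Shortest q → Dec (Adj u v)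
    from-shortest (stay u) _ = no λ adj → <-irrefl refl (<-≤-trans 0<1
      (≤-trans (wt≥1 u u adj) (≤-reflexive (trans (sym (edge-sp u u adj)) (d-refl u)))))
    from-shortest (step u x (adj , _) (stay _)) _ = yes adj
    from-shortest (step u x e (step w y e' r)) shortest = no λ adj →
      no-second-vertex r (∷-injectiveʳ (unique-sp u v (step u (wt u v) (adj , refl) (stay v))
        (step u x e (step w y e' r)) (trans (+-identityʳ _) (sym (edge-sp u v adj))) shortest))

  module _ {E : WRel n} (weight≡d : ∀ {u v x} → E u v x → x ≡ d u v) where

    expand : ∀ {a b} → Walk E a b → W a b
    expand (stay a)           = stay a
    expand (step u {v} _ _ q) = sp u v ++ʷ expand q

    len-expand : ∀ {a b} (q : Walk E a b) → len (expand q) ≡ len q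
    len-expand (stay a)           = refl
    len-expand (step u {v} x e q) = trans (len-++ʷ (sp u v) _)
      (cong₂ _+_ (trans (sp-shortest u v) (sym (weight≡d e))) (len-expand q))

    ∈-expand⁺ : ∀ {a b y} (q : Walk E a b) → y ∈ verts q → y ∈ verts (expand q)
    ∈-expand⁺ (stay a)           y∈q         = y∈q
    ∈-expand⁺ (step u {v} x e q) (here refl) = ∈-++ʷ⁺ˡ (sp u v) _ (start∈verts (sp u v))
    ∈-expand⁺ (step u {v} x e q) (there y∈q) = ∈-++ʷ⁺ʳ (sp u v) _ (∈-expand⁺ q y∈q)

    d≤len-shortcut : ∀ {a b} (q : Walk E a b) → d a b ≤ len q
    d≤len-shortcut q = ≤-trans (d≤len (expand q)) (≤-reflexive (len-expand q))

  junction≢ends : ∀ {a u y v b x z} (e : EG G a u x) (p : W u y) (e' : EG G y v z) (q : W v b) →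
                  Shortest (step a x e p ++ʷ step y z e' q) → y ≢ a × y ≢ b
  junction≢ends e p e' q shortest with ++ʷ-shortest⁻ (step _ _ e p) (step _ _ e' q) shortest
  ... | p-shortest , q-shortest = shortest-step⇒≢ e p p-shortest ∘ sym , shortest-step⇒≢ e' q q-shortest

module HierarchyFacts {n : ℕ} (G : Graph n) (d : Fin n → Fin n → ℚ) (st : Standing G d)
                      (C' : ℕ → List (Fin n)) (valid : Hierarchy.Valid G d C') where
  open Graph G
  open Standing st
  open ShortestPaths G d st
  open Hierarchy G d C'
  open DecMembership (Fin._≟_ {n}) using (_∈?_)

  C? : ∀ i → Decidable (C i)
  C? i x = (x ∈? C' i) ⊎-dec Fin.any? (λ v → adj? x v ×-dec (low i <? wt x v))

  heavy⇒C : ∀ i {u v} → Adj u v → low i < wt u v → C i u × C i v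
  heavy⇒C i {u} {v} adj low<wt =
    inj₂ (v , adj , low<wt) , inj₂ (u , adj-sym u v adj , subst (low i <_) (wt-sym u v adj) low<wt)

  adj⇒C0 : ∀ {u v} → Adj u v → C 0 u × C 0 v
  adj⇒C0 adj = heavy⇒C 0 adj (<-≤-trans (toWitness {a? = low 0 <? 1ℚ} _) (wt≥1 _ _ adj))

  step⇒C0 : ∀ {a v b x} → EG G a v x → W v b → C 0 a × C 0 b
  step⇒C0 (adj , _) (stay _)       = adj⇒C0 adj
  step⇒C0 (adj , _) (step _ _ e r) = proj₁ (adj⇒C0 adj) , proj₂ (step⇒C0 e r)

  C-closed : ∀ i {v w x} → C i v → (q : Walk (GE i) v w) → x ∈ verts q → C i x
  C-closed i cv (stay _)        (here refl) = cv
  C-closed i cv (step _ _ _ q)  (here refl) = cv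
  C-closed i cv (step _ _ uv q) (there x∈q) = C-closed i (proj₁ (proj₂ uv)) q x∈q

  run-mono : ∀ {i ps S T} → Run i ps S T → ∀ x → x ∈ S → x ∈ T
  run-mono done                   x x∈S = x∈S
  run-mono (skip _ _ _ run)       x x∈S = run-mono run x x∈S
  run-mono (add _ _ _ _ _ run)    x x∈S = run-mono run x (there x∈S)

  run-meets : ∀ {i ps S T} → Run i ps S T → ∀ {v v'} → (v , v') ∈ ps →
              Σ (Walk (PrevE i) v v') λ q → IsShortestIn (PrevE i) q × ∃ λ x → x ∈ verts q × x ∈ T
  run-meets (skip q shortest (x , x∈q , x∈S) run) (here refl) = q , shortest , x , x∈q , run-mono run x x∈S
  run-meets (add q shortest _ m (_ , m∈q , _) run) (here refl) =
    q , shortest , m , ∈-positionsFrom⁻ 0ℚ q m∈q , run-mono run m (here refl)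
  run-meets (skip _ _ _ run)    (there vv'∈ps) = run-meets run vv'∈ps
  run-meets (add _ _ _ _ _ run) (there vv'∈ps) = run-meets run vv'∈ps

  run-source : ∀ {i ps S T} → Run i ps S T → ∀ x → x ∈ T →
               x ∈ S ⊎ ∃[ v ] ∃[ v' ] (v , v') ∈ ps × Σ (Walk (PrevE i) v v') λ q → x ∈ verts q
  run-source done x x∈T = inj₁ x∈T
  run-source (skip q _ _ run) x x∈T with run-source run x x∈T
  ... | inj₁ x∈S                       = inj₁ x∈S
  ... | inj₂ (v , v' , vv'∈ , q' , x∈q') = inj₂ (v , v' , there vv'∈ , q' , x∈q')
  run-source (add q _ _ m (_ , m∈q , _) run) x x∈T with run-source run x x∈T
  ... | inj₁ (here refl)               = inj₂ (_ , _ , here refl , q , ∈-positionsFrom⁻ 0ℚ q m∈q)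
  ... | inj₁ (there x∈S)               = inj₁ x∈S
  ... | inj₂ (v , v' , vv'∈ , q' , x∈q') = inj₂ (v , v' , there vv'∈ , q' , x∈q')

  -- New elements of C'[i+1] lie on G[i]-paths between vertices of G[i], hence in C[i].
  C-suc⊆C : ∀ i x → C (suc i) x → C i x
  C-suc⊆C i x (inj₂ (v , adj , low<wt)) = inj₂ (v , adj , ≤-<-trans (low≤low-suc i) low<wt)
  C-suc⊆C i x (inj₁ x∈C') with valid (suc i)
  ... | ps , _ , qualifies , run with run-source run x x∈C'
  ... | inj₁ ()
  ... | inj₂ (v , v' , vv'∈ps , q , x∈q) = C-closed i (proj₁ (proj₂ (qualifies v v') vv'∈ps)) q x∈q

  GE-weight≡d : ∀ i {u v x} → GE i u v x → x ≡ d u v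
  GE-weight≡d i (_ , _ , _ , x≡ , _) = x≡

  -- low j = 8^(j-1), so Light (suc i) s bounds the edge weights of s by 8^i.
  Light : ℕ → ∀ {a b} → W a b → Set
  Light j s = All (_≤ low j) (weights s)

  light-edge : ∀ j {u v} → Adj u v → ¬ C j u ⊎ ¬ C j v → wt u v ≤ low j
  light-edge j adj (inj₁ ¬cu) = ≮⇒≥ λ low<wt → ¬cu (proj₁ (heavy⇒C j adj low<wt))
  light-edge j adj (inj₂ ¬cv) = ≮⇒≥ λ low<wt → ¬cv (proj₂ (heavy⇒C j adj low<wt))

  start∉tail : ∀ {a v b x z} (e : EG G a v x) (r : W v b) → Shortest (step a x e r) → z ∈ verts r → a ≢ z
  start∉tail e r shortest z∈r with cutAt r z∈r
  ... | cut r₁ r₂ refl , refl = shortest-step⇒≢ e r₁ (proj₁ (++ʷ-shortest⁻ (step _ _ e r₁) r₂ shortest))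

  avoidsBeforeEnd⇒light : ∀ j {a b} (s : W a b) → Shortest s → AvoidsBeforeEnd (C j) s → Light j s
  avoidsBeforeEnd⇒light j (stay _)                  _        _     = []
  avoidsBeforeEnd⇒light j (step a x (adj , refl) r) shortest avoid =
    light-edge j adj (inj₁ (avoid a (here refl) (shortest-step⇒≢ (adj , refl) r shortest)))
    ∷ avoidsBeforeEnd⇒light j r (shortest-step⁻ (adj , refl) r shortest) (λ y y∈r → avoid y (there y∈r))

  avoidsAfterStart⇒light : ∀ j {a b} (s : W a b) → Shortest s → AvoidsAfterStart (C j) s → Light j s
  avoidsAfterStart⇒light j (stay _)                  _        _     = []
  avoidsAfterStart⇒light j (step a x (adj , refl) r) shortest avoid =
    light-edge j adj
      (inj₂ (avoid _ (there (start∈verts r)) (start∉tail (adj , refl) r shortest (start∈verts r) ∘ sym)))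
    ∷ avoidsAfterStart⇒light j r (shortest-step⁻ (adj , refl) r shortest)
        (λ y y∈r _ → avoid y (there y∈r) (start∉tail (adj , refl) r shortest y∈r ∘ sym))

  avoidsInterior⇒light : ∀ j {a v w b x y} (e : EG G a v x) (e' : EG G v w y) (r : W w b) →
                          let s = step a x e (step v y e' r) in
                          Shortest s → AvoidsInterior (C j) s → Light j s
  avoidsInterior⇒light j (adj , refl) e' r shortest avoid =
    light-edge j adj (inj₂ (avoid _ (there (here refl)) (≢start (here refl)) (shortest-step⇒≢ e' r tail-shortest)))
    ∷ avoidsBeforeEnd⇒light j (step _ _ e' r) tail-shortest (λ z z∈ → avoid z (there z∈) (≢start z∈))
    where
    tail-shortest = shortest-step⁻ (adj , refl) (step _ _ e' r) shortest
    ≢start : ∀ {z} → z ∈ verts (step _ _ e' r) → z ≢ _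
    ≢start z∈ = start∉tail (adj , refl) (step _ _ e' r) shortest z∈ ∘ sym

  segment⇒edge : ∀ i {a v b x} (e : EG G a v x) (r : W v b) → let s = step a x e r in
                 Shortest s → C i a → C i b → AvoidsInterior (C i) s → len s ≤ pow8 i → GE i a b (d a b)
  segment⇒edge i {a} {b = b} e r shortest ca cb avoid len≤ =
    ca , cb , shortest-step⇒≢ e r shortest , refl , ≤-trans (≤-reflexive (sym shortest)) len≤ ,
    λ p p-shortest y y∈p cy → ends y (subst (y ∈_) (unique-sp a b p (step a _ e r) p-shortest shortest) y∈p) cy
    where
    ends : ∀ y → y ∈ verts (step a _ e r) → C i y → y ≡ a ⊎ y ≡ b
    ends y y∈s cy with y Fin.≟ a | y Fin.≟ b
    ... | yes y≡a | _       = inj₁ y≡a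
    ... | no _    | yes y≡b = inj₂ y≡b
    ... | no y≢a  | no y≢b  = ⊥-elim (avoid y y∈s y≢a y≢b cy)

  -- The pair (a, z) is examined when C'[i+1] is built, since γ shows d_{G[i]}(a, z) = |w|; the
  -- vertex of C'[i+1] on p_{G[i]}(a, z) lies on w because that path expands to the shortest path w.
  window-meets-C' : ∀ i {a z} (w : W a z) → Shortest w → C i a → C i z →
                    (γ : Walk (GE i) a z) → len γ ≡ len w → 6·8^ i ≤ len w → len w ≤ pow8 (suc i) →
                    Light (suc i) w → ∃ λ y → y ∈ verts w × y ∈ C' (suc i)
  window-meets-C' i {a} {z} w shortest ca cz γ len-γ 6·8^≤ ≤8^suc light = meets (valid (suc i))
    where
    qualifying : Qualifies (suc i) a z
    qualifying = ca , cz ,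
      (len w , ((γ , len-γ) , λ q → ≤-trans (≤-reflexive shortest) (d≤len-shortcut (GE-weight≡d i) q)) ,
               ≤-trans (≤-reflexive (¾·8^suc≡6·8^ i)) 6·8^≤ , ≤8^suc) ,
      λ p p-shortest → subst (All _) (sym (verts≡⇒weights≡ p w (unique-sp a z p w p-shortest shortest))) light

    on-w : (q : Walk (GE i) a z) → IsShortestIn (GE i) q → ∀ {y} → y ∈ verts q → y ∈ verts w
    on-w q q-shortest {y} y∈q =
      subst (y ∈_) (unique-sp a z q̂ w q̂-shortest shortest) (∈-expand⁺ (GE-weight≡d i) q y∈q)
      where
      q̂ = expand (GE-weight≡d i) q
      q̂-shortest : Shortest q̂
      q̂-shortest = ≤-antisym (begin
        len q̂     ≡⟨ len-expand (GE-weight≡d i) q ⟩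
        len q     ≤⟨ q-shortest γ ⟩
        len γ     ≡⟨ trans len-γ shortest ⟩
        d a z     ∎) (d≤len q̂)
        where open ≤-Reasoning

    meets : ValidLevel (suc i) → ∃ λ y → y ∈ verts w × y ∈ C' (suc i)
    meets (_ , _ , qualifies , run) =
      let q , q-shortest , y , y∈q , y∈C' = run-meets run (proj₁ (qualifies a z) qualifying)
      in  y , on-w q q-shortest y∈q , y∈C'

  SegmentBound : ℕ → Set
  SegmentBound i = ∀ {a b} (s : W a b) → Shortest s → C i a → C i b → AvoidsInterior (C i) s →
                   Light (suc i) s → len s ≤ pow8 i

  WindowHit : ℕ → ∀ {a b} → W a b → Set
  WindowHit i s = Σ (Cut s) λ c → C (suc i) (Cut.mid c) × len (Cut.pre c) ≤ 7·8^ i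

  Window : ℕ → Set
  Window i = ∀ {a b} (s : W a b) → Shortest s → C i a → C i b → Light (suc i) s → 6·8^ i ≤ len s → WindowHit i s

  next-edge : ∀ i → SegmentBound i → ∀ {z v b x} (e : EG G z v x) (r : W v b) → let σ = step z x e r in
              Shortest σ → C i z → C i b → Light (suc i) σ →
              Σ (Cut r) λ c → let σ₁ = step z x e (Cut.pre c) in
                C i (Cut.mid c) × len σ₁ ≤ pow8 i × GE i z (Cut.mid c) (len σ₁)
  next-edge i bound e r shortest cz cb light with findNext (C? i) cb e r
  ... | c@(cut r₁ r₂ refl) , cm , avoid =
        c , cm , σ₁≤ , subst (GE i _ _) (sym σ₁-shortest) (segment⇒edge i e r₁ σ₁-shortest cz cm avoid σ₁≤)
    where
    σ₁-cut = cut (step _ _ e r₁) r₂ refl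
    σ₁-shortest = proj₁ (cut-shortest σ₁-cut shortest)
    σ₁≤ = bound (step _ _ e r₁) σ₁-shortest cz cm avoid (proj₁ (All-weights-cut⁻ σ₁-cut light))

  GE↾ : ℕ → (Fin n → Set) → WRel n
  GE↾ i Q u v x = GE i u v x × Q u × Q v

  record LiftedPrefix (i : ℕ) (Q : Fin n → Set) {a b : Fin n} (s : W a b) : Set where
    constructor lifted
    field
      {mid}    : Fin n
      pre      : W a mid
      suf      : W mid b
      pre++suf : pre ++ʷ suf ≡ s
      C-mid    : C i mid
      pre↑     : Walk (GE↾ i Q) a mid
      len-pre↑ : len pre↑ ≡ len pre
  open LiftedPrefix using (pre; suf)

  module Lifting (i : ℕ) (Q : Fin n → Set) (bound : SegmentBound i) {a b : Fin n} {s : W a b}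
           (shortest : Shortest s) (cb : C i b) (light : Light (suc i) s) (inQ : ∀ y → y ∈ verts s → Q y) where

    extend : ∀ {z v x} (π : W a z) (e : EG G z v x) (r : W v b) → π ++ʷ step z x e r ≡ s → C i z →
             (γ : Walk (GE↾ i Q) a z) → len γ ≡ len π →
             Σ (LiftedPrefix i Q s) λ ℓ → #edges (suf ℓ) ℕ.≤ #edges r × len (pre ℓ) ≤ len π + pow8 i
    extend π e r πσ≡s cz γ len-γ
      with next-edge i bound e r (proj₂ (cut-shortest πσ shortest)) cz cb (proj₂ (All-weights-cut⁻ πσ light))
      where πσ = cut π (step _ _ e r) πσ≡s
    ... | cut r₁ r₂ refl , cm , σ₁≤ , edge =
          lifted (π ++ʷ σ₁) r₂ π'r₂≡s cm (γ ++ʷ step _ _ (edge , Qz , Qm) (stay _))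
                 (trans (len-++ʷ γ _) (trans (cong₂ _+_ len-γ (+-identityʳ _)) (sym (len-++ʷ π σ₁)))) ,
          #edges-suffix r₁ r₂ ,
          ≤-trans (≤-reflexive (len-++ʷ π σ₁)) (+-mono-≤ (≤-refl {len π}) σ₁≤)
      where
      σ₁ = step _ _ e r₁
      π'r₂≡s = trans (++ʷ-assoc π σ₁ r₂) πσ≡s
      Qz = inQ _ (mid∈verts (cut π (σ₁ ++ʷ r₂) πσ≡s))
      Qm = inQ _ (mid∈verts (cut (π ++ʷ σ₁) r₂ π'r₂≡s))

    start : C i a → LiftedPrefix i Q s
    start ca = lifted (stay a) s refl ca (stay a) refl

    lift-rest : (k : ℕ) (ℓ : LiftedPrefix i Q s) → #edges (suf ℓ) ℕ.≤ k →
                Σ (Walk (GE↾ i Q) a b) λ γ → len γ ≡ len s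
    lift-rest _       (lifted π (stay _) π≡s _ γ len-γ) _ =
      γ , trans len-γ (cong len (trans (sym (++ʷ-identityʳ π)) π≡s))
    lift-rest (suc k) (lifted π (step _ _ e r) πσ≡s cz γ len-γ) (s≤s #r≤k) with extend π e r πσ≡s cz γ len-γ
    ... | ℓ , #≤ , _ = lift-rest k ℓ (ℕ.≤-trans #≤ #r≤k)

    lift : C i a → Σ (Walk (GE↾ i Q) a b) λ γ → len γ ≡ len s
    lift ca = lift-rest (#edges s) (start ca) ℕ.≤-refl

    long-prefix-hit : C i a → (ℓ : LiftedPrefix i Q s) → 6·8^ i ≤ len (pre ℓ) → len (pre ℓ) ≤ 7·8^ i →
                      WindowHit i s
    long-prefix-hit ca (lifted π σ πσ≡s cz γ len-γ) 6·8^≤π π≤7·8^ =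
      let πσ = cut π σ πσ≡s
          y , y∈π , y∈C' = window-meets-C' i π (proj₁ (cut-shortest πσ shortest)) ca cz
                             (mapʷ proj₁ γ) (trans (len-mapʷ proj₁ γ) len-γ)
                             6·8^≤π (≤-trans π≤7·8^ (7·8^≤8^suc i)) (proj₁ (All-weights-cut⁻ πσ light))
          c , mid≡y = cutAt π y∈π
      in  cut-++ʷʳ c σ πσ≡s , inj₁ (subst (_∈ C' (suc i)) (sym mid≡y) y∈C') , ≤-trans (len-pre≤ c) π≤7·8^

    -- Follow s from one C[i]-vertex to the next, by hops of length at most 8^i, until the lifted
    -- prefix is at least 6·8^i long; it is then shorter than 7·8^i.
    march : C i a → 6·8^ i ≤ len s → (k : ℕ) (ℓ : LiftedPrefix i Q s) → #edges (suf ℓ) ℕ.≤ k →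
            len (pre ℓ) < 6·8^ i → WindowHit i s
    march _ 6·8^≤s _ (lifted π (stay _) π≡s _ _ _) _ π<6·8^ = ⊥-elim (<-irrefl refl (<-≤-trans π<6·8^
      (≤-trans 6·8^≤s (≤-reflexive (cong len (trans (sym π≡s) (++ʷ-identityʳ π)))))))
    march ca 6·8^≤s (suc k) (lifted π (step _ _ e r) πσ≡s cz γ len-γ) (s≤s #r≤k) π<6·8^
      with extend π e r πσ≡s cz γ len-γ
    ... | ℓ , #≤ , π'≤ with 6·8^ i ≤? len (pre ℓ)
    ... | no  π'≱ = march ca 6·8^≤s k ℓ (ℕ.≤-trans #≤ #r≤k) (≰⇒> π'≱)
    ... | yes π'≥ = long-prefix-hit ca ℓ π'≥
          (≤-trans π'≤ (<⇒≤ (<-≤-trans (+-mono-<-≤ π<6·8^ (≤-refl {pow8 i})) (≤-reflexive (6·8^+8^≡7·8^ i)))))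

  window : ∀ i → SegmentBound i → Window i
  window i bound s shortest ca cb light 6·8^≤s = march ca 6·8^≤s (#edges s) (start ca) ℕ.≤-refl (0<6·8^ i)
    where open Lifting i (λ _ → ⊤) bound shortest cb light (λ _ _ → tt)

  segment-bound-0 : SegmentBound 0
  segment-bound-0 (stay _)              _ _ _ _ _          = 0≤1
  segment-bound-0 (step _ x _ (stay _)) _ _ _ _ (x≤1 ∷ []) = ≤-trans (≤-reflexive (+-identityʳ x)) x≤1
  segment-bound-0 (step a x e (step v y (adj , y≡) r)) shortest _ _ avoid _ =
    let v≢a , v≢b = junction≢ends e (stay v) (adj , y≡) r shortest
    in  ⊥-elim (avoid v (there (here refl)) v≢a v≢b (proj₁ (adj⇒C0 adj)))

  -- If s were longer than 8^(i+1), the window lemma applied after the first hop of s would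
  -- produce a vertex of C[i+1] strictly inside s.
  segment-bound-step : ∀ i → SegmentBound i → Window i → ∀ {a v b x} (e : EG G a v x) (r : W v b) →
                       let s = step a x e r in Shortest s → C (suc i) a → C (suc i) b →
                       AvoidsInterior (C (suc i)) s → Light (suc i) s → len s ≤ pow8 (suc i)
  segment-bound-step i bound window {a} {b = b} e r shortest ca cb avoid light
    with next-edge i bound e r shortest (C-suc⊆C i _ ca) (C-suc⊆C i _ cb) light
  ... | cut r₁ r₂ refl , cm , σ₁≤ , _ = ≮⇒≥ λ 8^suc<s →
          let c , cy , w₁≤ = window r₂ r₂-shortest cm (C-suc⊆C i _ cb) r₂-light (r₂-long 8^suc<s)
          in  avoid (Cut.mid c) (mid∈verts (cut-++ʷˡ σ₁ c)) (junction≢start c) (junction≢end c w₁≤ 8^suc<s) cy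
    where
    open ≤-Reasoning
    σ₁ = step _ _ e r₁
    σ₁r₂ = cut σ₁ r₂ refl
    r₂-shortest = proj₂ (cut-shortest σ₁r₂ shortest)
    r₂-light = proj₂ (All-weights-cut⁻ σ₁r₂ light)

    r₂-long : pow8 (suc i) < len (σ₁ ++ʷ r₂) → 6·8^ i ≤ len r₂
    r₂-long 8^suc<s = ≮⇒≥ λ r₂<6·8^ → <-irrefl refl (<-≤-trans 8^suc<s (begin
      len (σ₁ ++ʷ r₂)  ≡⟨ len-++ʷ σ₁ r₂ ⟩
      len σ₁ + len r₂  ≤⟨ ≤8^+≤7·8^⇒≤8^suc i σ₁≤ (≤-trans (<⇒≤ r₂<6·8^) (6·8^≤7·8^ i)) ⟩
      pow8 (suc i)     ∎))

    junction≢start : (c : Cut r₂) → Cut.mid c ≢ a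
    junction≢start c =
      shortest-step⇒≢ e (r₁ ++ʷ Cut.pre c) (proj₁ (cut-shortest (cut-++ʷˡ σ₁ c) shortest)) ∘ sym

    junction≢end : (c : Cut r₂) → len (Cut.pre c) ≤ 7·8^ i → pow8 (suc i) < len (σ₁ ++ʷ r₂) → Cut.mid c ≢ b
    junction≢end c w₁≤ 8^suc<s y≡b = <-irrefl refl (<-≤-trans 8^suc<s (begin
      len (σ₁ ++ʷ r₂)           ≡⟨ len-++ʷ σ₁ r₂ ⟩
      len σ₁ + len r₂           ≡⟨ cong (_+_ (len σ₁)) (len-cut-at-end c r₂-shortest y≡b) ⟩
      len σ₁ + len (Cut.pre c)  ≤⟨ ≤8^+≤7·8^⇒≤8^suc i σ₁≤ w₁≤ ⟩
      pow8 (suc i)              ∎))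

  segment-bound : ∀ i → SegmentBound i
  segment-bound zero    = segment-bound-0
  segment-bound (suc i) = segment-bound-suc
    where
    segment-bound-suc : SegmentBound (suc i)
    segment-bound-suc (stay _)              _ _ _ _ _         = 0≤8^ (suc i)
    segment-bound-suc (step _ x _ (stay _)) _ _ _ _ (x≤ ∷ []) = ≤-trans (≤-reflexive (+-identityʳ x)) x≤
    segment-bound-suc (step a x e r@(step _ _ e' r')) shortest ca cb avoid _ =
      segment-bound-step i (segment-bound i) (window i (segment-bound i)) e r shortest ca cb avoid
        (avoidsInterior⇒light (suc i) e e' r' shortest avoid)

  avoids⇒<6·8^ : ∀ i {a b} (s : W a b) → Shortest s → C i a → C i b → Avoids (C (suc i)) s → len s < 6·8^ i
  avoids⇒<6·8^ i s shortest ca cb avoid = ≰⇒> λ 6·8^≤s →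
    let light = avoidsBeforeEnd⇒light (suc i) s shortest (λ y y∈s _ → avoid y y∈s)
        c , cy , _ = window i (segment-bound i) s shortest ca cb light 6·8^≤s
    in  avoid _ (mid∈verts c) cy

  avoidsBeforeEnd⇒≤7·8^ : ∀ i {a b} (s : W a b) → Shortest s → C i a → C (suc i) b →
                           AvoidsBeforeEnd (C (suc i)) s → len s ≤ 7·8^ i
  avoidsBeforeEnd⇒≤7·8^ i {b = b} s shortest ca cb avoid with 6·8^ i ≤? len s
  ... | no  s≱ = ≤-trans (<⇒≤ (≰⇒> s≱)) (6·8^≤7·8^ i)
  ... | yes s≥
    with window i (segment-bound i) s shortest ca (C-suc⊆C i _ cb) (avoidsBeforeEnd⇒light (suc i) s shortest avoid) s≥
  ... | c , cy , pre≤ with Cut.mid c Fin.≟ b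
  ... | no  y≢b = ⊥-elim (avoid _ (mid∈verts c) y≢b cy)
  ... | yes y≡b = ≤-trans (≤-reflexive (len-cut-at-end c shortest y≡b)) pre≤

  avoidsAfterStart⇒≤7·8^ : ∀ i {a b} (s : W a b) → Shortest s → C (suc i) a → C i b →
                            AvoidsAfterStart (C (suc i)) s → len s ≤ 7·8^ i
  avoidsAfterStart⇒≤7·8^ i s shortest ca cb avoid =
    subst (_≤ 7·8^ i) (len-reverse s)
      (avoidsBeforeEnd⇒≤7·8^ i (reverse s) (reverse-shortest s shortest) cb ca (λ y → avoid y ∘ ∈-reverse⁻ s))

module Funnel {n : ℕ} (G : Graph n) (d : Fin n → Fin n → ℚ) (st : Standing G d)
              (C' : ℕ → List (Fin n)) (valid : Hierarchy.Valid G d C') (v₁ v₂ : Fin n) where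
  open Graph G
  open Standing st
  open ShortestPaths G d st
  open Hierarchy G d C'
  open HierarchyFacts G d st C' valid

  F : WRel n
  F = FunnelE v₁ v₂

  NearEnds : ℕ → Fin n → Set
  NearEnds i y = InBall v₁ (pow8 (suc i)) y ⊎ InBall v₂ (pow8 (suc i)) y

  d≤lenF : ∀ {a b} (Γ : Walk F a b) → d a b ≤ len Γ
  d≤lenF = d≤len-shortcut λ (i , uv , _) → GE-weight≡d i uv

  0≤lenF : ∀ {a b} (Γ : Walk F a b) → 0ℚ ≤ len Γ
  0≤lenF Γ = ≤-trans (d-nonneg _ _) (d≤lenF Γ)

  lift-near : ∀ i {a b} (σ : W a b) → Shortest σ → C i a → C i b → Light (suc i) σ →
              (∀ y → y ∈ verts σ → NearEnds i y) → Σ (Walk F a b) λ Γ → len Γ ≡ len σ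
  lift-near i σ shortest ca cb light near =
    let γ , len-γ = Lifting.lift i (NearEnds i) (segment-bound i) shortest cb light near ca
    in  mapʷ (λ (uv , near-u , near-v) → i , uv , near-u , near-v) γ , trans (len-mapʷ _ γ) len-γ

  d-v₁≤ : ∀ {f g y} (A : Walk F v₁ f) (σ : W f g) → y ∈ verts σ → d v₁ y ≤ len A + len σ
  d-v₁≤ {f} A σ y∈σ with cutAt σ y∈σ
  ... | c , refl = begin
    d v₁ (Cut.mid c)                  ≤⟨ d-triangle v₁ f (Cut.mid c) ⟩
    d v₁ f + d f (Cut.mid c)          ≤⟨ +-mono-≤ (d≤lenF A) (≤-trans (d≤len (Cut.pre c)) (len-pre≤ c)) ⟩
    len A + len σ                     ∎
    where open ≤-Reasoning

  d-v₂≤ : ∀ {g e y} (σ : W g e) (Ω : Walk F e v₂) → y ∈ verts σ → d v₂ y ≤ len σ + len Ω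
  d-v₂≤ {e = e} σ Ω y∈σ with cutAt σ y∈σ
  ... | c , refl = begin
    d v₂ (Cut.mid c)                  ≡⟨ d-sym v₂ (Cut.mid c) ⟩
    d (Cut.mid c) v₂                  ≤⟨ d-triangle (Cut.mid c) e v₂ ⟩
    d (Cut.mid c) e + d e v₂          ≤⟨ +-mono-≤ (≤-trans (d≤len (Cut.suf c)) (len-suf≤ c)) (d≤lenF Ω) ⟩
    len σ + len Ω                     ∎
    where open ≤-Reasoning

  ShortestFunnelWalk : Set
  ShortestFunnelWalk = Σ (Walk F v₁ v₂) λ q → len q ≡ d v₁ v₂

  -- Invariant at level i: A μ Ω has length d(v₁, v₂), and only its middle part μ, a shortest path
  -- of G between vertices of C[i], still has to be replaced by a funnel walk.
  record Progress (i : ℕ) : Set where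
    constructor progress
    field
      {f e}      : Fin n
      A          : Walk F v₁ f
      μ          : W f e
      Ω          : Walk F e v₂
      μ-shortest : Shortest μ
      total      : len A + len μ + len Ω ≡ d v₁ v₂
      C-f        : C i f
      C-e        : C i e
      A≤         : len A ≤ pow8 i
      Ω≤         : len Ω ≤ pow8 i

  finish : ∀ i (P : Progress i) → let open Progress P in
           Light (suc i) μ → (∀ y → y ∈ verts μ → NearEnds i y) → ShortestFunnelWalk
  finish i (progress A μ Ω μ-shortest total C-f C-e _ _) light near =
    let M , len-M = lift-near i μ μ-shortest C-f C-e light near
    in  A ++ʷ M ++ʷ Ω , (begin
      len (A ++ʷ M ++ʷ Ω)        ≡⟨ len-++ʷ A (M ++ʷ Ω) ⟩
      len A + len (M ++ʷ Ω)      ≡⟨ cong (_+_ (len A)) (len-++ʷ M Ω) ⟩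
      len A + (len M + len Ω)    ≡⟨ +-assoc (len A) (len M) (len Ω) ⟨
      len A + len M + len Ω      ≡⟨ cong (λ t → len A + t + len Ω) len-M ⟩
      len A + len μ + len Ω      ≡⟨ total ⟩
      d v₁ v₂                    ∎)
    where open ≡-Reasoning

  finish-short : ∀ i → Progress i → d v₁ v₂ ≤ pow8 i → ShortestFunnelWalk
  finish-short i P@(progress A μ Ω _ total _ _ _ _) d≤8^ =
    finish i P (All.map (λ x≤μ → ≤-trans x≤μ μ≤8^) (weights≤len μ))
               (λ y y∈μ → inj₁ (≤-trans (d-v₁≤ A μ y∈μ) (≤-trans Aμ≤8^ (8^≤8^suc i))))
    where
    Aμ≤8^ : len A + len μ ≤ pow8 i
    Aμ≤8^ = ≤-trans (x≤x+y (0≤lenF Ω)) (≤-trans (≤-reflexive total) d≤8^)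
    μ≤8^ : len μ ≤ pow8 i
    μ≤8^ = ≤-trans (x≤x+y (0≤lenF A)) (≤-trans (≤-reflexive (+-comm (len μ) (len A))) Aμ≤8^)

  finish-avoiding : ∀ i (P : Progress i) → Avoids (C (suc i)) (Progress.μ P) → ShortestFunnelWalk
  finish-avoiding i P@(progress A μ Ω μ-shortest _ C-f C-e A≤ _) avoid =
    finish i P (avoidsBeforeEnd⇒light (suc i) μ μ-shortest (λ y y∈μ _ → avoid y y∈μ))
      (λ y y∈μ → inj₁ (≤-trans (d-v₁≤ A μ y∈μ)
        (≤8^+≤7·8^⇒≤8^suc i A≤ (≤-trans (<⇒≤ (avoids⇒<6·8^ i μ μ-shortest C-f C-e avoid)) (6·8^≤7·8^ i)))))

  regroup : ∀ {f f' e' e} (A : Walk F v₁ f) (A₁ : Walk F f f') (μ₁ : W f f') (μ₃ : W f' e') (μ₄ : W e' e)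
            (Ω₄ : Walk F e' e) (Ω : Walk F e v₂) → len A₁ ≡ len μ₁ → len Ω₄ ≡ len μ₄ →
            len (A ++ʷ A₁) + len μ₃ + len (Ω₄ ++ʷ Ω) ≡ len A + len (μ₁ ++ʷ μ₃ ++ʷ μ₄) + len Ω
  regroup A A₁ μ₁ μ₃ μ₄ Ω₄ Ω len-A₁ len-Ω₄ = begin
    len (A ++ʷ A₁) + len μ₃ + len (Ω₄ ++ʷ Ω)      ≡⟨ cong₂ (λ a w → a + len μ₃ + w) len-A' len-Ω' ⟩
    len A + len μ₁ + len μ₃ + (len μ₄ + len Ω)    ≡⟨ +-regroup (len A) (len μ₁) (len μ₃) (len μ₄) (len Ω) ⟩
    len A + (len μ₁ + (len μ₃ + len μ₄)) + len Ω  ≡⟨ cong (λ m → len A + m + len Ω) len-μ ⟨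
    len A + len (μ₁ ++ʷ μ₃ ++ʷ μ₄) + len Ω        ∎
    where
    open ≡-Reasoning
    open +-*-Solver
    len-A' = trans (len-++ʷ A A₁) (cong (_+_ (len A)) len-A₁)
    len-Ω' = trans (len-++ʷ Ω₄ Ω) (cong (_+ len Ω) len-Ω₄)
    len-μ  = trans (len-++ʷ μ₁ (μ₃ ++ʷ μ₄)) (cong (_+_ (len μ₁)) (len-++ʷ μ₃ μ₄))
    +-regroup : ∀ a m₁ m₃ m₄ w → a + m₁ + m₃ + (m₄ + w) ≡ a + (m₁ + (m₃ + m₄)) + w
    +-regroup = solve 5 (λ a m₁ m₃ m₄ w → a :+ m₁ :+ m₃ :+ (m₄ :+ w) := a :+ (m₁ :+ (m₃ :+ m₄)) :+ w) refl

  -- Cut μ at its first and last vertices in C[i+1]. The outer pieces avoid C[i+1] elsewhere, so they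
  -- are at most 7·8^i long; hence they stay within 8^(i+1) of v₁ resp. v₂ and lift to G[i].
  advance : ∀ i (P : Progress i) → FirstHit (C (suc i)) (Progress.μ P) → Progress (suc i)
  advance i (progress A μ Ω μ-shortest total C-f C-e A≤ Ω≤) (cut μ₁ μ₂ refl , C-f' , avoid₁)
    with findLast (C? (suc i)) μ₂
  ... | inj₁ avoid = ⊥-elim (avoid _ (start∈verts μ₂) C-f')
  ... | inj₂ (cut μ₃ μ₄ refl , C-e' , avoid₄) =
        progress (A ++ʷ A₁) μ₃ (Ω₄ ++ʷ Ω) (proj₁ μ₃₄-shortest)
                 (trans (regroup A A₁ μ₁ μ₃ μ₄ Ω₄ Ω (proj₂ lift₁) (proj₂ lift₄)) total) C-f' C-e' A'≤ Ω'≤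
    where
    μ₁₂-shortest = ++ʷ-shortest⁻ μ₁ (μ₃ ++ʷ μ₄) μ-shortest
    μ₃₄-shortest = ++ʷ-shortest⁻ μ₃ μ₄ (proj₂ μ₁₂-shortest)
    μ₁≤ = avoidsBeforeEnd⇒≤7·8^ i μ₁ (proj₁ μ₁₂-shortest) C-f C-f' avoid₁
    μ₄≤ = avoidsAfterStart⇒≤7·8^ i μ₄ (proj₂ μ₃₄-shortest) C-e' C-e avoid₄

    lift₁ = lift-near i μ₁ (proj₁ μ₁₂-shortest) C-f (C-suc⊆C i _ C-f')
              (avoidsBeforeEnd⇒light (suc i) μ₁ (proj₁ μ₁₂-shortest) avoid₁)
              (λ y y∈μ₁ → inj₁ (≤-trans (d-v₁≤ A μ₁ y∈μ₁) (≤8^+≤7·8^⇒≤8^suc i A≤ μ₁≤)))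
    lift₄ = lift-near i μ₄ (proj₂ μ₃₄-shortest) (C-suc⊆C i _ C-e') C-e
              (avoidsAfterStart⇒light (suc i) μ₄ (proj₂ μ₃₄-shortest) avoid₄)
              (λ y y∈μ₄ → inj₂ (≤-trans (d-v₂≤ μ₄ Ω y∈μ₄)
                (≤-trans (≤-reflexive (+-comm (len μ₄) (len Ω))) (≤8^+≤7·8^⇒≤8^suc i Ω≤ μ₄≤))))
    A₁ = proj₁ lift₁
    Ω₄ = proj₁ lift₄

    len-A' : len (A ++ʷ A₁) ≡ len A + len μ₁
    len-A' = trans (len-++ʷ A A₁) (cong (_+_ (len A)) (proj₂ lift₁))
    len-Ω' : len (Ω₄ ++ʷ Ω) ≡ len Ω + len μ₄
    len-Ω' = trans (len-++ʷ Ω₄ Ω) (trans (cong (_+ len Ω) (proj₂ lift₄)) (+-comm (len μ₄) (len Ω)))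

    A'≤ = ≤-trans (≤-reflexive len-A') (≤8^+≤7·8^⇒≤8^suc i A≤ μ₁≤)
    Ω'≤ = ≤-trans (≤-reflexive len-Ω') (≤8^+≤7·8^⇒≤8^suc i Ω≤ μ₄≤)

  climb : (k i : ℕ) → d v₁ v₂ ≤ pow8 (k ℕ.+ i) → Progress i → ShortestFunnelWalk
  climb zero    i d≤8^ P = finish-short i P d≤8^
  climb (suc k) i d≤8^ P with findFirst (C? (suc i)) (Progress.μ P)
  ... | inj₁ avoid = finish-avoiding i P avoid
  ... | inj₂ hit   = climb k (suc i) (subst (λ j → d v₁ v₂ ≤ pow8 j) (sym (ℕ.+-suc k i)) d≤8^) (advance i P hit)

  shortest-funnel-walk : ShortestFunnelWalk
  shortest-funnel-walk with sp v₁ v₂ | sp-shortest v₁ v₂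
  ... | stay _         | shortest = stay v₁ , shortest
  ... | p@(step _ _ e r) | shortest =
        let k , d≤8^k = 8^-unbounded (d v₁ v₂)
        in  climb k 0 (subst (λ j → d v₁ v₂ ≤ pow8 j) (sym (ℕ.+-identityʳ k)) d≤8^k)
              (progress (stay v₁) p (stay v₂) shortest (trans (+-identityʳ _) (trans (+-identityˡ _) shortest))
                        (proj₁ (step⇒C0 e r)) (proj₂ (step⇒C0 e r)) 0≤1 0≤1)

  funnel-distance : IsDistIn F v₁ v₂ (d v₁ v₂)
  funnel-distance = shortest-funnel-walk , d≤lenF

mainTheorem15 : (n : ℕ) (G : Graph n) (d : Fin n → Fin n → ℚ) (h : ℕ) →
    Standing G d → HighwayDim≤ G d h →
    (C' : ℕ → List (Fin n)) → Hierarchy.Valid G d C' →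
    (v₁ v₂ : Fin n) →
    IsDistIn (Hierarchy.FunnelE G d C' v₁ v₂) v₁ v₂ (d v₁ v₂)
mainTheorem15 n G d _ st _ C' valid v₁ v₂ = Funnel.funnel-distance G d st C' valid v₁ v₂
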